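{- Let $\Gamma=\mathrm{Cay}({\mathbb Z}_g\oplus{\mathbb Z}_{N/g},\{(u_{11},u_{21}),(u_{12},u_{22})\})$ be a $2$--Cayley digraph with related minimum distance diagram $\mathcal{H}=\mathrm{L}(l,h,w,y)$ of area $N=lh-wy$ and $\gcd(\mathcal{H})=\gcd(l,h,w,y)=g\geq1$. Then, (a) for any $m\in{\mathbb N}$, $m\neq0$, the $m$-extension given by Procedure E, i.e. the digraph related to $m\mathcal{H}=\mathrm{L}(ml,mh,mw,my)$, is $m\Gamma=\mathrm{Cay}({\mathbb Z}_{mg}\oplus{\mathbb Z}_{(mN)/g},\{(u_{11},u_{21}),(u_{12},u_{22})\})$; (b) if $m\in{\mathbb N}$ is a divisor of $g$, then the $m$-quotient given by Procedure Q, i.e. the digraph related to $\mathcal{H}/m=\mathrm{L}(l/m,h/m,w/m,y/m)$, is $\Gamma/m=\mathrm{Cay}({\mathbb Z}_{g/m}\oplus{\mathbb Z}_{N/(gm)},\{(u_{11},u_{21}),(u_{12},u_{22})\})$.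
   Context: For a finite Abelian group $\mathrm{G}_N$ of order $N$ and generators $a,b$, $\mathrm{Cay}(\mathrm{G}_N,\{a,b\})$ has vertex set $\mathrm{G}_N$ and arcs $g\to g+a$, $g\to g+b$. A minimum distance diagram (MDD, L-shape) $\mathrm{L}(l,h,w,y)$ with $0\le w<l$, $0\le y<h$ is related to $\mathrm{Cay}(\mathrm{G}_N,\{a,b\})$ iff $lh-wy=N$, $la=yb$ and $hb=wa$ in $\mathrm{G}_N$, $(l-y)(h-w)\ge0$ and both factors do not vanish simultaneously. Given the MDD, a related digraph is obtained from the Smith normal form $S=\mathrm{diag}(s_1,s_2)=UMV$ of $M=\begin{pmatrix}l&-w\\-y&h\end{pmatrix}$, with $s_1=\gcd(l,h,w,y)$, $s_1s_2=N$, $U=(u_{ij})$, $V$ unimodular integer matrices: the MDD is related to $\mathrm{Cay}({\mathbb Z}_{s_1}\oplus{\mathbb Z}_{s_2},\{(u_{11},u_{21}),(u_{12},u_{22})\})$. Procedure E: for an MDD $\mathcal{H}$ related to $\Gamma$, the digraph $m\Gamma$ related to $m\mathcal{H}$ is called the $m$-extension of $\Gamma$. Procedure Q: for $m\mid\gcd(\mathcal{H})$, the digraph $\Gamma/m$ related to $\mathcal{H}/m$ is called the $m$-quotient of $\Gamma$. It is known (previous theorem in the paper) that $m\mathcal{H}$, and $\mathcal{H}/m$ when $m\mid\gcd(\mathcal{H})$, are again minimum distance diagrams. -}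

module Defs where

open import Data.Nat as ℕ using (ℕ; _≤_; _<_)
open import Data.Nat.GCD using (gcd)
open import Data.Integer as ℤ using (ℤ; +_; _-_; -_)
open import Data.Product using (_×_; _,_)
open import Data.Sum using (_⊎_)
open import Relation.Binary.PropositionalEquality using (_≡_)
open import Relation.Nullary using (¬_)

record Mat2 : Set where
  constructor mat
  field
    a11 a12 a21 a22 : ℤ
open Mat2 public

infixl 7 _·_
_·_ : Mat2 → Mat2 → Mat2
A · B = mat (a11 A ℤ.* a11 B ℤ.+ a12 A ℤ.* a21 B)
            (a11 A ℤ.* a12 B ℤ.+ a12 A ℤ.* a22 B)
            (a21 A ℤ.* a11 B ℤ.+ a22 A ℤ.* a21 B)
            (a21 A ℤ.* a12 B ℤ.+ a22 A ℤ.* a22 B)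

det : Mat2 → ℤ
det A = a11 A ℤ.* a22 A - a12 A ℤ.* a21 A

Unimodular : Mat2 → Set
Unimodular A = (det A ≡ + 1) ⊎ (det A ≡ - + 1)

diag : ℤ → ℤ → Mat2
diag s t = mat s (+ 0) (+ 0) t

record LShape : Set where
  constructor L
  field
    l h w y : ℕ
open LShape public

area : LShape → ℤ
area H = (+ l H) ℤ.* (+ h H) - (+ w H) ℤ.* (+ y H)

gcdL : LShape → ℕ
gcdL H = gcd (gcd (l H) (h H)) (gcd (w H) (y H))

matL : LShape → Mat2
matL H = mat (+ l H) (- (+ w H)) (- (+ y H)) (+ h H)

scaleL : ℕ → LShape → LShape
scaleL m H = L (m ℕ.* l H) (m ℕ.* h H) (m ℕ.* w H) (m ℕ.* y H)

IsLShapeMDD : LShape → Set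
IsLShapeMDD H =
  (w H < l H) × (y H < h H) ×
  (+ 0 ℤ.≤ ((+ l H) - (+ y H)) ℤ.* ((+ h H) - (+ w H))) ×
  ¬ (((+ l H) - (+ y H) ≡ + 0) × ((+ h H) - (+ w H) ≡ + 0))

-- A 2-Cayley digraph  Cay(Z_{n1} ⊕ Z_{n2}, {a, b})  with a, b given by integer
-- representatives of their coordinates.
record Cay2 : Set where
  constructor cay
  field
    n1 n2 : ℕ
    gen-a gen-b : ℤ × ℤ
open Cay2 public

-- The digraph related to the MDD H obtained from the Smith normal form
-- S = diag(s1,s2) = U M V (U, V unimodular, s1 = gcd(H), s1 s2 = N):
-- Cay(Z_{s1} ⊕ Z_{s2}, {(u11,u21),(u12,u22)}).
RelatedViaSNF : LShape → Mat2 → Mat2 → Cay2 → Set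
RelatedViaSNF H U V Γ =
  Unimodular U × Unimodular V ×
  (U · matL H · V ≡ diag (+ n1 Γ) (+ n2 Γ)) ×
  (n1 Γ ≡ gcdL H) ×
  ((+ n1 Γ) ℤ.* (+ n2 Γ) ≡ area H) ×
  (gen-a Γ ≡ (a11 U , a21 U)) ×
  (gen-b Γ ≡ (a12 U , a22 U))

-- Scaling an L-shape by m scales its matrix M, hence also U M V, by m. So the same
-- unimodular pair (U, V) brings m M to the Smith normal form diag(m s₁, m s₂): the related
-- digraph keeps the generators read off U and only its cyclic factors are multiplied by m.
-- Division by m is the converse, since a nonzero factor m can be cancelled throughout.
module Submission where

open import Defs
open import Data.Nat using (ℕ; _*_; _≤_)
open import Data.Nat.Divisibility using (_∣_)
open import Data.Integer using (+_)
open import Data.Product using (_×_; _,_)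
open import Relation.Binary.PropositionalEquality using (_≡_)

open import Data.Nat using (suc; NonZero)
open import Data.Nat.Properties using (*-cancelˡ-≡; *-assoc; *-comm; m*n≢0⇒m≢0)
open import Data.Nat.GCD using (gcd; c*gcd[m,n]≡gcd[cm,cn])
open import Data.Integer as ℤ using (ℤ)
import Data.Integer.Properties as ℤ
open import Data.Integer.Tactic.RingSolver using (solve-∀)
open import Relation.Binary.PropositionalEquality using (refl; sym; trans; cong; cong₂; subst; subst₂)
open Relation.Binary.PropositionalEquality.≡-Reasoning

scale : ℤ → Mat2 → Mat2
scale c A = mat (c ℤ.* a11 A) (c ℤ.* a12 A) (c ℤ.* a21 A) (c ℤ.* a22 A)

mat-cong : ∀ {a b c d a′ b′ c′ d′} → a ≡ a′ → b ≡ b′ → c ≡ c′ → d ≡ d′ →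
           mat a b c d ≡ mat a′ b′ c′ d′
mat-cong refl refl refl refl = refl

scale-middle-entry : ∀ (c m₁₁ m₁₂ m₂₁ m₂₂ p q r s : ℤ) →
  (p ℤ.* (c ℤ.* m₁₁) ℤ.+ q ℤ.* (c ℤ.* m₂₁)) ℤ.* r ℤ.+ (p ℤ.* (c ℤ.* m₁₂) ℤ.+ q ℤ.* (c ℤ.* m₂₂)) ℤ.* s
  ≡ c ℤ.* ((p ℤ.* m₁₁ ℤ.+ q ℤ.* m₂₁) ℤ.* r ℤ.+ (p ℤ.* m₁₂ ℤ.+ q ℤ.* m₂₂) ℤ.* s)
scale-middle-entry = solve-∀

scale-middle : ∀ c U M V → U · scale c M · V ≡ scale c (U · M · V)
scale-middle c (mat u₁₁ u₁₂ u₂₁ u₂₂) (mat m₁₁ m₁₂ m₂₁ m₂₂) (mat v₁₁ v₁₂ v₂₁ v₂₂) =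
  mat-cong (scale-middle-entry c m₁₁ m₁₂ m₂₁ m₂₂ u₁₁ u₁₂ v₁₁ v₂₁)
           (scale-middle-entry c m₁₁ m₁₂ m₂₁ m₂₂ u₁₁ u₁₂ v₁₂ v₂₂)
           (scale-middle-entry c m₁₁ m₁₂ m₂₁ m₂₂ u₂₁ u₂₂ v₁₁ v₂₁)
           (scale-middle-entry c m₁₁ m₁₂ m₂₁ m₂₂ u₂₁ u₂₂ v₁₂ v₂₂)

scale-injective : ∀ c {A B} .{{_ : ℤ.NonZero c}} → scale c A ≡ scale c B → A ≡ B
scale-injective c eq =
  mat-cong (ℤ.*-cancelˡ-≡ c _ _ (cong a11 eq)) (ℤ.*-cancelˡ-≡ c _ _ (cong a12 eq))
           (ℤ.*-cancelˡ-≡ c _ _ (cong a21 eq)) (ℤ.*-cancelˡ-≡ c _ _ (cong a22 eq))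

scale-diag : ∀ m s t → scale (+ m) (diag (+ s) (+ t)) ≡ diag (+ (m * s)) (+ (m * t))
scale-diag m s t =
  mat-cong (sym (ℤ.pos-* m s)) (ℤ.*-zeroʳ (+ m)) (ℤ.*-zeroʳ (+ m)) (sym (ℤ.pos-* m t))

*-scale-both : ∀ c a b → (c ℤ.* a) ℤ.* (c ℤ.* b) ≡ c ℤ.* (c ℤ.* (a ℤ.* b))
*-scale-both = solve-∀

pos-*-scale-both : ∀ m s t → + (m * s) ℤ.* + (m * t) ≡ + m ℤ.* (+ m ℤ.* (+ s ℤ.* + t))
pos-*-scale-both m s t =
  trans (cong₂ ℤ._*_ (ℤ.pos-* m s) (ℤ.pos-* m t)) (*-scale-both (+ m) (+ s) (+ t))

matL-scaleL : ∀ m H → matL (scaleL m H) ≡ scale (+ m) (matL H)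
matL-scaleL m (L l h w y) =
  mat-cong (ℤ.pos-* m l) (neg-pos-* w) (neg-pos-* y) (ℤ.pos-* m h)
  where
  neg-pos-* : ∀ n → ℤ.- (+ (m * n)) ≡ + m ℤ.* ℤ.- (+ n)
  neg-pos-* n = trans (cong ℤ.-_ (ℤ.pos-* m n)) (ℤ.neg-distribʳ-* (+ m) (+ n))

area-scaleL : ∀ m H → area (scaleL m H) ≡ + m ℤ.* (+ m ℤ.* area H)
area-scaleL m (L l h w y) = begin
  + (m * l) ℤ.* + (m * h) ℤ.- + (m * w) ℤ.* + (m * y)
    ≡⟨ cong₂ ℤ._-_ (pos-*-scale-both m l h) (pos-*-scale-both m w y) ⟩
  + m ℤ.* (+ m ℤ.* (+ l ℤ.* + h)) ℤ.- + m ℤ.* (+ m ℤ.* (+ w ℤ.* + y))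
    ≡⟨ factor (+ m) (+ l ℤ.* + h) (+ w ℤ.* + y) ⟩
  + m ℤ.* (+ m ℤ.* (+ l ℤ.* + h ℤ.- + w ℤ.* + y)) ∎
  where
  factor : ∀ c a b → c ℤ.* (c ℤ.* a) ℤ.- c ℤ.* (c ℤ.* b) ≡ c ℤ.* (c ℤ.* (a ℤ.- b))
  factor = solve-∀

gcdL-scaleL : ∀ m H → gcdL (scaleL m H) ≡ m * gcdL H
gcdL-scaleL m (L l h w y) = sym (trans (c*gcd[m,n]≡gcd[cm,cn] m _ _)
  (cong₂ gcd (c*gcd[m,n]≡gcd[cm,cn] m l h) (c*gcd[m,n]≡gcd[cm,cn] m w y)))

RelatedViaSNF-scaleL : ∀ m {H U V s t a b} →
  RelatedViaSNF H U V (cay s t a b) →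
  RelatedViaSNF (scaleL m H) U V (cay (m * s) (m * t) a b)
RelatedViaSNF-scaleL m {H} {U} {V} {s} {t} (uU , uV , snf , s≡gcd , st≡area , ga , gb) =
  uU , uV , snf′ , s≡gcd′ , st≡area′ , ga , gb
  where
  snf′ : U · matL (scaleL m H) · V ≡ diag (+ (m * s)) (+ (m * t))
  snf′ = begin
    U · matL (scaleL m H) · V        ≡⟨ cong (λ X → U · X · V) (matL-scaleL m H) ⟩
    U · scale (+ m) (matL H) · V     ≡⟨ scale-middle (+ m) U (matL H) V ⟩
    scale (+ m) (U · matL H · V)     ≡⟨ cong (scale (+ m)) snf ⟩
    scale (+ m) (diag (+ s) (+ t))   ≡⟨ scale-diag m s t ⟩
    diag (+ (m * s)) (+ (m * t))     ∎
  s≡gcd′ : m * s ≡ gcdL (scaleL m H)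
  s≡gcd′ = trans (cong (m *_) s≡gcd) (sym (gcdL-scaleL m H))
  st≡area′ : + (m * s) ℤ.* + (m * t) ≡ area (scaleL m H)
  st≡area′ = begin
    + (m * s) ℤ.* + (m * t)            ≡⟨ pos-*-scale-both m s t ⟩
    + m ℤ.* (+ m ℤ.* (+ s ℤ.* + t))    ≡⟨ cong (λ X → + m ℤ.* (+ m ℤ.* X)) st≡area ⟩
    + m ℤ.* (+ m ℤ.* area H)           ≡⟨ sym (area-scaleL m H) ⟩
    area (scaleL m H)                  ∎

RelatedViaSNF-unscaleL : ∀ m .{{_ : NonZero m}} {H U V s t a b} →
  RelatedViaSNF (scaleL m H) U V (cay (m * s) (m * t) a b) →
  RelatedViaSNF H U V (cay s t a b)
RelatedViaSNF-unscaleL m {H} {U} {V} {s} {t} (uU , uV , snf , s≡gcd , st≡area , ga , gb) =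
  uU , uV , snf′ , s≡gcd′ , st≡area′ , ga , gb
  where
  snf′ : U · matL H · V ≡ diag (+ s) (+ t)
  snf′ = scale-injective (+ m) (begin
    scale (+ m) (U · matL H · V)     ≡⟨ sym (scale-middle (+ m) U (matL H) V) ⟩
    U · scale (+ m) (matL H) · V     ≡⟨ cong (λ X → U · X · V) (sym (matL-scaleL m H)) ⟩
    U · matL (scaleL m H) · V        ≡⟨ snf ⟩
    diag (+ (m * s)) (+ (m * t))     ≡⟨ sym (scale-diag m s t) ⟩
    scale (+ m) (diag (+ s) (+ t))   ∎)
  s≡gcd′ : s ≡ gcdL H
  s≡gcd′ = *-cancelˡ-≡ s (gcdL H) m (trans s≡gcd (gcdL-scaleL m H))
  st≡area′ : + s ℤ.* + t ≡ area H
  st≡area′ = ℤ.*-cancelˡ-≡ (+ m) _ _ (ℤ.*-cancelˡ-≡ (+ m) _ _ (begin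
    + m ℤ.* (+ m ℤ.* (+ s ℤ.* + t))    ≡⟨ sym (pos-*-scale-both m s t) ⟩
    + (m * s) ℤ.* + (m * t)            ≡⟨ st≡area ⟩
    area (scaleL m H)                  ≡⟨ area-scaleL m H ⟩
    + m ℤ.* (+ m ℤ.* area H)           ∎))

proposition1 : (H : LShape) → IsLShapeMDD H →
    (N g s2 : ℕ) → area H ≡ + N → gcdL H ≡ g → 1 ≤ g → g * s2 ≡ N →
    (U V : Mat2) →
    RelatedViaSNF H U V (cay g s2 (a11 U , a21 U) (a12 U , a22 U)) →
    ((m : ℕ) → 1 ≤ m → (k : ℕ) → g * k ≡ m * N →
    RelatedViaSNF (scaleL m H) U V (cay (m * g) k (a11 U , a21 U) (a12 U , a22 U)))
    ×
    ((m : ℕ) → m ∣ g → (H' : LShape) → scaleL m H' ≡ H →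
    (g' k : ℕ) → m * g' ≡ g → (g * m) * k ≡ N →
    RelatedViaSNF H' U V (cay g' k (a11 U , a21 U) (a12 U , a22 U)))
proposition1 H _ N g@(suc _) s2 _ _ _ gs2≡N U V related = extension , quotient
  where
  extension : (m : ℕ) → 1 ≤ m → (k : ℕ) → g * k ≡ m * N →
    RelatedViaSNF (scaleL m H) U V (cay (m * g) k (a11 U , a21 U) (a12 U , a22 U))
  extension m _ k gk≡mN =
    subst (λ t → RelatedViaSNF (scaleL m H) U V (cay (m * g) t (a11 U , a21 U) (a12 U , a22 U)))
      (sym k≡ms2) (RelatedViaSNF-scaleL m related)
    where
    k≡ms2 : k ≡ m * s2
    k≡ms2 = *-cancelˡ-≡ k (m * s2) g (begin
      g * k          ≡⟨ gk≡mN ⟩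
      m * N          ≡⟨ cong (m *_) (sym gs2≡N) ⟩
      m * (g * s2)   ≡⟨ sym (*-assoc m g s2) ⟩
      m * g * s2     ≡⟨ cong (_* s2) (*-comm m g) ⟩
      g * m * s2     ≡⟨ *-assoc g m s2 ⟩
      g * (m * s2)   ∎)
  quotient : (m : ℕ) → m ∣ g → (H' : LShape) → scaleL m H' ≡ H →
    (g' k : ℕ) → m * g' ≡ g → (g * m) * k ≡ N →
    RelatedViaSNF H' U V (cay g' k (a11 U , a21 U) (a12 U , a22 U))
  quotient m _ H' refl g' k mg'≡g gmk≡N =
    RelatedViaSNF-unscaleL m {{m≢0}}
      (subst₂ (λ s t → RelatedViaSNF H U V (cay s t (a11 U , a21 U) (a12 U , a22 U)))
        (sym mg'≡g) s2≡mk related)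
    where
    m≢0 : NonZero m
    m≢0 = m*n≢0⇒m≢0 m {g'} {{subst NonZero (sym mg'≡g) _}}
    s2≡mk : s2 ≡ m * k
    s2≡mk = *-cancelˡ-≡ s2 (m * k) g (trans gs2≡N (trans (sym gmk≡N) (*-assoc g m k)))
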